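{- Let $n>1$ be an odd integer and let $k\in\mathbb{Z}$. Then the polynomial $$f_{n,k}(x)=k\sum_{j\geq 0}\binom{n-1}{2j+1}(x^j-x^{j+1})+2\sum_{j\geq 0}\binom{n}{2j}x^j\in\mathbb{Z}[x]$$ is self-reciprocal if and only if either $k=1$, or $k=3$ and $n=3$.
   Context: Binomial coefficients $\binom{a}{b}$ are $0$ when $b>a$. A nonzero polynomial $f(x)$ of (actual) degree $d\ge 0$ is called self-reciprocal if $x^d f(1/x)=f(x)$, i.e. if $f(x)=\sum_{i=0}^d a_ix^i$ with $a_d\neq 0$ then $a_i=a_{d-i}$ for all $0\le i\le d$. Nonzero constant polynomials count as self-reciprocal. -}

module Defs where

open import Data.Nat using (ℕ; zero; suc; _<_; _≤_; _∸_)
open import Data.Nat.Combinatorics using (_C_)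
open import Data.Integer using (ℤ; +_; _+_; _-_; _*_)
open import Data.Product using (Σ; _×_)
open import Relation.Binary.PropositionalEquality using (_≡_)
open import Relation.Nullary using (¬_)

-- A polynomial in ℤ[x] is represented by its coefficient sequence ℕ → ℤ
-- (coefficient of x^i at index i); all polynomials used here have finite support.

SelfReciprocal : (ℕ → ℤ) → Set
SelfReciprocal a =
  Σ ℕ λ d → (¬ (a d ≡ + 0))
          × ((i : ℕ) → d < i → a i ≡ + 0)
          × ((i : ℕ) → i ≤ d → a i ≡ a (d ∸ i))

-- Coefficient of x^i in  Σ_{j≥0} C(n-1,2j+1) (x^j - x^{j+1}):
-- from x^j with j = i we get C(n-1,2i+1); from -x^{j+1} with j = i-1 (i ≥ 1) we get -C(n-1,2i-1).
oddPart : ℕ → ℕ → ℤ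
oddPart n zero    = + ((n ∸ 1) C 1)
oddPart n (suc i) = + ((n ∸ 1) C (2 Data.Nat.* suc i Data.Nat.+ 1)) - + ((n ∸ 1) C (2 Data.Nat.* i Data.Nat.+ 1))

evenPart : ℕ → ℕ → ℤ
evenPart n i = + (n C (2 Data.Nat.* i))

f : ℕ → ℤ → ℕ → ℤ
f n k i = k * oddPart n i + + 2 * evenPart n i

-- Write n = 2m + 1. Every coefficient of f_{n,k} above x^m vanishes, the constant term is
-- 2(1 + km) and the coefficient of x^m is 2(1 + (2 − k)m). If the latter is 0 then
-- (k − 2)m = 1, so m = 1, k = 3, and f = 8 is constant. Otherwise f has degree m and
-- self-reciprocity equates the two end coefficients, giving k = 1. Conversely, two
-- applications of Pascal's rule give f_{n,1}(x) = Σ_i C(n+1, 2i+1) x^i, which is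
-- palindromic because C(n+1, c) = C(n+1, n+1−c).

module Submission where

open import Defs
open import Data.Nat using (ℕ; _<_; _%_)
open import Data.Integer using (ℤ; +_)
open import Data.Product using (_×_)
open import Data.Sum using (_⊎_)
open import Function.Bundles using (_⇔_)
open import Relation.Binary.PropositionalEquality using (_≡_)

open import Data.Nat as ℕ using (zero; suc; _≤_; z≤n; s≤s; _∸_; NonZero)
import Data.Nat.Properties as ℕ
open import Data.Nat.Combinatorics using (_C_; k>n⇒nCk≡0; nCk≡nC[n∸k]; nC1≡n; nCk+nC[k+1]≡[n+1]C[k+1])
open import Data.Nat.DivMod using (_/_; m≡m%n+[m/n]*n)
open import Data.Integer as ℤ using (_+_; _-_; _*_; ∣_∣)
import Data.Integer.Properties as ℤ
import Data.Integer.Tactic.RingSolver as ℤ-Solver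
import Data.Nat.Tactic.RingSolver as ℕ-Solver
open import Data.Product using (_,_)
open import Data.Sum using (inj₁; inj₂)
open import Relation.Binary.PropositionalEquality using (refl; subst; sym; trans; cong; cong₂; module ≡-Reasoning)
open import Relation.Binary.Definitions using (tri<; tri≈; tri>)
open import Relation.Nullary using (¬_; yes; no; contradiction)
open import Function.Bundles using (mk⇔)

open ≡-Reasoning

selfReciprocal⇒ends-equal : ∀ {a : ℕ → ℤ} {m} → (∀ i → m < i → a i ≡ + 0) → ¬ (a m ≡ + 0) →
                            SelfReciprocal a → a 0 ≡ a m
selfReciprocal⇒ends-equal {a} {m} vanishes a[m]≢0 (d , a[d]≢0 , above-d , symmetric) with ℕ.<-cmp d m
... | tri< d<m _ _ = contradiction (above-d m d<m) a[m]≢0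
... | tri> _ _ m<d = contradiction (vanishes d m<d) a[d]≢0
... | tri≈ _ refl _ = symmetric 0 z≤n

[m+n]Cm≡[m+n]Cn : ∀ m n → (m ℕ.+ n) C m ≡ (m ℕ.+ n) C n
[m+n]Cm≡[m+n]Cn m n = trans (nCk≡nC[n∸k] (ℕ.m≤m+n m n)) (cong ((m ℕ.+ n) C_) (ℕ.m+n∸m≡n m n))

[1+n]Cn≡1+n : ∀ n → suc n C n ≡ suc n
[1+n]Cn≡1+n n = trans (sym ([m+n]Cm≡[m+n]Cn 1 n)) (nC1≡n (suc n))

nC[2+k]-nCk+2[1+n]C[1+k]≡[2+n]C[2+k] : ∀ n k →
  + (n C (2 ℕ.+ k)) - + (n C k) + + 2 * + (suc n C suc k) ≡ + ((2 ℕ.+ n) C (2 ℕ.+ k))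
nC[2+k]-nCk+2[1+n]C[1+k]≡[2+n]C[2+k] n k = begin
  + c₂ - + c₀ + + 2 * + (suc n C suc k)  ≡⟨ cong (λ x → + c₂ - + c₀ + + 2 * + x) (sym (pascal n k)) ⟩
  + c₂ - + c₀ + + 2 * (+ c₀ + + c₁)      ≡⟨ regroup (+ c₀) (+ c₁) (+ c₂) ⟩
  + (c₀ ℕ.+ c₁) + + (c₁ ℕ.+ c₂)          ≡⟨ cong₂ (λ x y → + x + + y) (pascal n k) (pascal n (suc k)) ⟩
  + (suc n C suc k ℕ.+ suc n C (2 ℕ.+ k)) ≡⟨ cong +_ (pascal (suc n) (suc k)) ⟩
  + ((2 ℕ.+ n) C (2 ℕ.+ k))              ∎
  where
  c₀ = n C k
  c₁ = n C suc k
  c₂ = n C (2 ℕ.+ k)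
  pascal = nCk+nC[k+1]≡[n+1]C[k+1]
  regroup : ∀ x y z → z - x + + 2 * (x + y) ≡ (x + y) + (y + z)
  regroup = ℤ-Solver.solve-∀

f-vanishes-above : ∀ m k i → m < i → f (suc (2 ℕ.* m)) k i ≡ + 0
f-vanishes-above m k (suc j) (s≤s m≤j) =
  combination-of-zeros (k>n⇒nCk≡0 2m<2[1+j]+1) (k>n⇒nCk≡0 2m<2j+1) (k>n⇒nCk≡0 1+2m<2[1+j])
  where
  combination-of-zeros : ∀ {a b c} → a ≡ 0 → b ≡ 0 → c ≡ 0 → k * (+ a - + b) + + 2 * + c ≡ + 0
  combination-of-zeros refl refl refl = trans (ℤ.+-identityʳ _) (ℤ.*-zeroʳ k)
  2m<2[1+j]+1 : 2 ℕ.* m < 2 ℕ.* suc j ℕ.+ 1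
  2m<2[1+j]+1 = ℕ.<-≤-trans (ℕ.*-monoʳ-< 2 (s≤s m≤j)) (ℕ.m≤m+n _ 1)
  2m<2j+1 : 2 ℕ.* m < 2 ℕ.* j ℕ.+ 1
  2m<2j+1 = subst (2 ℕ.* m <_) (ℕ.+-comm 1 (2 ℕ.* j)) (s≤s (ℕ.*-monoʳ-≤ 2 m≤j))
  1+2m<2[1+j] : suc (2 ℕ.* m) < 2 ℕ.* suc j
  1+2m<2[1+j] = subst (_≤ 2 ℕ.* suc j) (ℕ.*-suc 2 m) (ℕ.*-monoʳ-≤ 2 (s≤s m≤j))

f-constant : ∀ m k → f (suc (2 ℕ.* m)) k 0 ≡ + 2 * (+ 1 + k * + m)
f-constant m k = begin
  k * + (2 ℕ.* m C 1) + + 2 * + 1 ≡⟨ cong (λ x → k * + x + + 2 * + 1) (nC1≡n (2 ℕ.* m)) ⟩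
  k * + (2 ℕ.* m) + + 2 * + 1     ≡⟨ cong (λ x → k * x + + 2 * + 1) (ℤ.pos-* 2 m) ⟩
  k * (+ 2 * + m) + + 2 * + 1     ≡⟨ factor k (+ m) ⟩
  + 2 * (+ 1 + k * + m)           ∎
  where
  factor : ∀ k x → k * (+ 2 * x) + + 2 * + 1 ≡ + 2 * (+ 1 + k * x)
  factor = ℤ-Solver.solve-∀

f-top : ∀ m k → f (suc (2 ℕ.* m)) k m ≡ + 2 * (+ 1 + (+ 2 - k) * + m)
f-top zero k = factor k
  where
  factor : ∀ k → k * + 0 + + 2 * + 1 ≡ + 2 * (+ 1 + (+ 2 - k) * + 0)
  factor = ℤ-Solver.solve-∀
f-top m@(suc p) k = begin
  k * (+ (2m C (2 ℕ.* m ℕ.+ 1)) - + (2m C (2 ℕ.* p ℕ.+ 1))) + + 2 * + (suc 2m C 2m)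
    ≡⟨ cong (λ x → k * (+ x - + (2m C (2 ℕ.* p ℕ.+ 1))) + + 2 * + (suc 2m C 2m))
            (k>n⇒nCk≡0 (ℕ.m<m+n 2m (s≤s z≤n))) ⟩
  k * (+ 0 - + (2m C (2 ℕ.* p ℕ.+ 1))) + + 2 * + (suc 2m C 2m)
    ≡⟨ cong₂ (λ x y → k * (+ 0 - + x) + + 2 * + y) 2mC[2m-1]≡2m ([1+n]Cn≡1+n 2m) ⟩
  k * (+ 0 - + 2m) + + 2 * (+ 1 + + 2m)
    ≡⟨ cong (λ x → k * (+ 0 - x) + + 2 * (+ 1 + x)) (ℤ.pos-* 2 m) ⟩
  k * (+ 0 - + 2 * + m) + + 2 * (+ 1 + + 2 * + m)
    ≡⟨ factor k (+ m) ⟩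
  + 2 * (+ 1 + (+ 2 - k) * + m) ∎
  where
  2m = 2 ℕ.* m
  factor : ∀ k x → k * (+ 0 - + 2 * x) + + 2 * (+ 1 + + 2 * x) ≡ + 2 * (+ 1 + (+ 2 - k) * x)
  factor = ℤ-Solver.solve-∀
  2[1+p]≡1+[2p+1] : ∀ p → 2 ℕ.* suc p ≡ suc (2 ℕ.* p ℕ.+ 1)
  2[1+p]≡1+[2p+1] = ℕ-Solver.solve-∀
  2mC[2m-1]≡2m : 2m C (2 ℕ.* p ℕ.+ 1) ≡ 2m
  2mC[2m-1]≡2m = begin
    2m C (2 ℕ.* p ℕ.+ 1)                   ≡⟨ cong (_C (2 ℕ.* p ℕ.+ 1)) (2[1+p]≡1+[2p+1] p) ⟩
    suc (2 ℕ.* p ℕ.+ 1) C (2 ℕ.* p ℕ.+ 1)  ≡⟨ [1+n]Cn≡1+n _ ⟩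
    suc (2 ℕ.* p ℕ.+ 1)                    ≡⟨ sym (2[1+p]≡1+[2p+1] p) ⟩
    2m                                     ∎

f-at-one : ∀ n i → f (suc n) (+ 1) i ≡ + ((2 ℕ.+ n) C (2 ℕ.* i ℕ.+ 1))
f-at-one n zero = begin
  + 1 * + (n C 1) + + 2 * + 1 ≡⟨ cong (λ x → x + + 2 * + 1) (ℤ.*-identityˡ (+ (n C 1))) ⟩
  + (n C 1 ℕ.+ 2)             ≡⟨ cong (λ x → + (x ℕ.+ 2)) (nC1≡n n) ⟩
  + (n ℕ.+ 2)                 ≡⟨ cong +_ (ℕ.+-comm n 2) ⟩
  + (2 ℕ.+ n)                 ≡⟨ cong +_ (sym (nC1≡n (2 ℕ.+ n))) ⟩
  + ((2 ℕ.+ n) C 1)           ∎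
f-at-one n (suc j) = begin
  + 1 * (+ (n C (2 ℕ.* suc j ℕ.+ 1)) - + (n C c)) + + 2 * + (suc n C (2 ℕ.* suc j))
    ≡⟨ cong (λ x → x + + 2 * + (suc n C (2 ℕ.* suc j))) (ℤ.*-identityˡ (+ (n C (2 ℕ.* suc j ℕ.+ 1)) - + (n C c))) ⟩
  + (n C (2 ℕ.* suc j ℕ.+ 1)) - + (n C c) + + 2 * + (suc n C (2 ℕ.* suc j))
    ≡⟨ cong₂ (λ x y → + (n C x) - + (n C c) + + 2 * + (suc n C y)) 2[1+j]+1≡2+c 2[1+j]≡1+c ⟩
  + (n C (2 ℕ.+ c)) - + (n C c) + + 2 * + (suc n C suc c)
    ≡⟨ nC[2+k]-nCk+2[1+n]C[1+k]≡[2+n]C[2+k] n c ⟩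
  + ((2 ℕ.+ n) C (2 ℕ.+ c))
    ≡⟨ cong (λ x → + ((2 ℕ.+ n) C x)) (sym 2[1+j]+1≡2+c) ⟩
  + ((2 ℕ.+ n) C (2 ℕ.* suc j ℕ.+ 1)) ∎
  where
  c = 2 ℕ.* j ℕ.+ 1
  2[1+j]+1≡2+c : 2 ℕ.* suc j ℕ.+ 1 ≡ 2 ℕ.+ c
  2[1+j]+1≡2+c = solve j
    where solve : ∀ j → 2 ℕ.* suc j ℕ.+ 1 ≡ 2 ℕ.+ (2 ℕ.* j ℕ.+ 1)
          solve = ℕ-Solver.solve-∀
  2[1+j]≡1+c : 2 ℕ.* suc j ≡ suc c
  2[1+j]≡1+c = solve j
    where solve : ∀ j → 2 ℕ.* suc j ≡ suc (2 ℕ.* j ℕ.+ 1)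
          solve = ℕ-Solver.solve-∀

f-at-one-palindromic : ∀ m i → i ≤ m → f (suc (2 ℕ.* m)) (+ 1) i ≡ f (suc (2 ℕ.* m)) (+ 1) (m ∸ i)
f-at-one-palindromic m i i≤m with ℕ.m≤n⇒∃[o]m+o≡n i≤m
... | j , refl = begin
  f (suc (2 ℕ.* m)) (+ 1) i                      ≡⟨ f-at-one (2 ℕ.* m) i ⟩
  + ((2 ℕ.+ 2 ℕ.* m) C (2 ℕ.* i ℕ.+ 1))          ≡⟨ cong (λ x → + (x C (2 ℕ.* i ℕ.+ 1))) 2+2m≡[2i+1]+[2j+1] ⟩
  + (((2 ℕ.* i ℕ.+ 1) ℕ.+ (2 ℕ.* j ℕ.+ 1)) C (2 ℕ.* i ℕ.+ 1))
    ≡⟨ cong +_ ([m+n]Cm≡[m+n]Cn (2 ℕ.* i ℕ.+ 1) (2 ℕ.* j ℕ.+ 1)) ⟩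
  + (((2 ℕ.* i ℕ.+ 1) ℕ.+ (2 ℕ.* j ℕ.+ 1)) C (2 ℕ.* j ℕ.+ 1))
    ≡⟨ cong₂ (λ x y → + (x C (2 ℕ.* y ℕ.+ 1))) (sym 2+2m≡[2i+1]+[2j+1]) (sym (ℕ.m+n∸m≡n i j)) ⟩
  + ((2 ℕ.+ 2 ℕ.* m) C (2 ℕ.* (m ∸ i) ℕ.+ 1))    ≡⟨ sym (f-at-one (2 ℕ.* m) (m ∸ i)) ⟩
  f (suc (2 ℕ.* m)) (+ 1) (m ∸ i)                ∎
  where
  2+2m≡[2i+1]+[2j+1] : 2 ℕ.+ 2 ℕ.* (i ℕ.+ j) ≡ (2 ℕ.* i ℕ.+ 1) ℕ.+ (2 ℕ.* j ℕ.+ 1)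
  2+2m≡[2i+1]+[2j+1] = solve i j
    where solve : ∀ i j → 2 ℕ.+ 2 ℕ.* (i ℕ.+ j) ≡ (2 ℕ.* i ℕ.+ 1) ℕ.+ (2 ℕ.* j ℕ.+ 1)
          solve = ℕ-Solver.solve-∀

f-at-one-selfReciprocal : ∀ m → SelfReciprocal (f (suc (2 ℕ.* m)) (+ 1))
f-at-one-selfReciprocal m = m , top≢0 , f-vanishes-above m (+ 1) , f-at-one-palindromic m
  where
  top≡2[1+m] : f (suc (2 ℕ.* m)) (+ 1) m ≡ + 2 * + suc m
  top≡2[1+m] = trans (f-top m (+ 1)) (cong (λ x → + 2 * (+ 1 + x)) (ℤ.*-identityˡ (+ m)))
  top≢0 : ¬ (f (suc (2 ℕ.* m)) (+ 1) m ≡ + 0)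
  top≢0 top≡0 with trans (sym top≡2[1+m]) top≡0
  ... | ()

equal-ends⇒k≡1 : ∀ m k .{{_ : NonZero m}} →
                  + 2 * (+ 1 + k * + m) ≡ + 2 * (+ 1 + (+ 2 - k) * + m) → k ≡ + 1
equal-ends⇒k≡1 m k ends≡ =
  ℤ.i-j≡0⇒i≡j k (+ 1) (ℤ.*-cancelʳ-≡ (k - + 1) (+ 0) (+ m) (ℤ.*-cancelʳ-≡ _ (+ 0) (+ 4) (begin
    (k - + 1) * + m * + 4                                  ≡⟨ difference k (+ m) ⟩
    + 2 * (+ 1 + k * + m) - + 2 * (+ 1 + (+ 2 - k) * + m)  ≡⟨ ℤ.i≡j⇒i-j≡0 ends≡ ⟩
    + 0                                                    ∎)))
  where
  difference : ∀ k x → (k - + 1) * x * + 4 ≡ + 2 * (+ 1 + k * x) - + 2 * (+ 1 + (+ 2 - k) * x)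
  difference = ℤ-Solver.solve-∀

vanishing-top⇒k≡3∧m≡1 : ∀ m k → + 2 * (+ 1 + (+ 2 - k) * + m) ≡ + 0 → k ≡ + 3 × m ≡ 1
vanishing-top⇒k≡3∧m≡1 m k top≡0 = k≡3 , m≡1
  where
  [k-2]m≡1 : (k - + 2) * + m ≡ + 1
  [k-2]m≡1 = ℤ.*-cancelˡ-≡ (+ 2) _ (+ 1) (begin
    + 2 * ((k - + 2) * + m)             ≡⟨ rearrange k (+ m) ⟩
    + 2 - + 2 * (+ 1 + (+ 2 - k) * + m) ≡⟨ cong (+ 2 -_) top≡0 ⟩
    + 2                                 ∎)
    where
    rearrange : ∀ k x → + 2 * ((k - + 2) * x) ≡ + 2 - + 2 * (+ 1 + (+ 2 - k) * x)
    rearrange = ℤ-Solver.solve-∀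
  m≡1 : m ≡ 1
  m≡1 = ℕ.m*n≡1⇒n≡1 ∣ k - + 2 ∣ m (trans (sym (ℤ.abs-* (k - + 2) (+ m))) (cong ∣_∣ [k-2]m≡1))
  k≡3 : k ≡ + 3
  k≡3 = begin
    k                     ≡⟨ shift k ⟩
    (k - + 2) * + 1 + + 2 ≡⟨ cong (λ x → (k - + 2) * + x + + 2) (sym m≡1) ⟩
    (k - + 2) * + m + + 2 ≡⟨ cong (_+ + 2) [k-2]m≡1 ⟩
    + 3                   ∎
    where
    shift : ∀ k → k ≡ (k - + 2) * + 1 + + 2
    shift = ℤ-Solver.solve-∀

f-3-3-selfReciprocal : SelfReciprocal (f 3 (+ 3))
f-3-3-selfReciprocal = 0 , (λ ()) , vanishes , λ { zero z≤n → refl }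
  where
  vanishes : ∀ i → 0 < i → f 3 (+ 3) i ≡ + 0
  vanishes 1                 _ = refl
  vanishes i@(suc (suc _))   _ = f-vanishes-above 1 (+ 3) i (s≤s (s≤s z≤n))

f-selfReciprocal⇔ : ∀ m k .{{_ : NonZero m}} →
  SelfReciprocal (f (suc (2 ℕ.* m)) k) ⇔ (k ≡ + 1 ⊎ (k ≡ + 3 × suc (2 ℕ.* m) ≡ 3))
f-selfReciprocal⇔ m k = mk⇔ forward backward
  where
  forward : SelfReciprocal (f (suc (2 ℕ.* m)) k) → k ≡ + 1 ⊎ (k ≡ + 3 × suc (2 ℕ.* m) ≡ 3)
  forward selfRec with f (suc (2 ℕ.* m)) k m ℤ.≟ + 0
  ... | yes top≡0 = let k≡3 , m≡1 = vanishing-top⇒k≡3∧m≡1 m k (trans (sym (f-top m k)) top≡0)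
                    in inj₂ (k≡3 , cong (λ m → suc (2 ℕ.* m)) m≡1)
  ... | no top≢0 = inj₁ (equal-ends⇒k≡1 m k (begin
    + 2 * (+ 1 + k * + m)         ≡⟨ sym (f-constant m k) ⟩
    f (suc (2 ℕ.* m)) k 0         ≡⟨ selfReciprocal⇒ends-equal (f-vanishes-above m k) top≢0 selfRec ⟩
    f (suc (2 ℕ.* m)) k m         ≡⟨ f-top m k ⟩
    + 2 * (+ 1 + (+ 2 - k) * + m) ∎))
  backward : k ≡ + 1 ⊎ (k ≡ + 3 × suc (2 ℕ.* m) ≡ 3) → SelfReciprocal (f (suc (2 ℕ.* m)) k)
  backward (inj₁ refl)         = f-at-one-selfReciprocal m
  backward (inj₂ (refl , n≡3)) =
    subst (λ m → SelfReciprocal (f (suc (2 ℕ.* m)) (+ 3))) (sym (ℕ.*-cancelˡ-≡ m 1 2 (ℕ.suc-injective n≡3)))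
          f-3-3-selfReciprocal

odd⇒≡1+2*[n/2] : ∀ n → n % 2 ≡ 1 → n ≡ suc (2 ℕ.* (n / 2))
odd⇒≡1+2*[n/2] n n-odd = trans (m≡m%n+[m/n]*n n 2) (cong₂ ℕ._+_ n-odd (ℕ.*-comm (n / 2) 2))

theorem2p4 : (n : ℕ) (k : ℤ) → n % 2 ≡ 1 → 1 < n →
    SelfReciprocal (f n k) ⇔ (k ≡ + 1 ⊎ (k ≡ + 3 × n ≡ 3))
theorem2p4 n k n-odd 1<n with n / 2 | odd⇒≡1+2*[n/2] n n-odd
... | zero  | refl = contradiction 1<n (ℕ.<-irrefl refl)
... | suc p | refl = f-selfReciprocal⇔ (suc p) k
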